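{- Let $A_n$ be the total number of 1-ascents, summed over all dispersed Dyck paths of length $n$. Then \[ \sum_{n\ge0}A_nz^n=\frac{z^2\bigl(1-4z^2+\sqrt{1-4z^2}\bigr)}{2(1-2z)(1-4z^2)}=\frac{z^2}{2(1-2z)}+\frac{z^2}{2(1-4z^2)^{3/2}}+\frac{z^3}{(1-4z^2)^{3/2}}. \]
   Context: A dispersed Dyck path of length $n$ is a sequence of $n$ steps, each an up-step $U=(1,1)$, a down-step $D=(1,-1)$, or a flat step $H=(1,0)$, starting at $(0,0)$, ending on the $x$-axis, never going below the $x$-axis, such that flat steps occur only on the $x$-axis. An ascent is a maximal run of consecutive $U$ steps; a 1-ascent is an ascent consisting of exactly one $U$ step. -}

module Defs where

open import Data.Nat using (ℕ; zero; suc; _∸_)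
open import Data.Bool using (Bool; true; false; if_then_else_; _∧_)
open import Data.List using (List; []; _∷_; map; concatMap)
open import Data.Nat.ListAction using (sum)
open import Data.Integer using (ℤ; +_; -_) renaming (_+_ to _+ℤ_; _*_ to _*ℤ_)

data Step : Set where
  U D H : Step

allSeqs : ℕ → List (List Step)
allSeqs zero = [] ∷ []
allSeqs (suc n) = concatMap (λ s → (U ∷ s) ∷ (D ∷ s) ∷ (H ∷ s) ∷ []) (allSeqs n)

dispersedFrom : ℕ → List Step → Bool
dispersedFrom zero    []       = true
dispersedFrom (suc h) []       = false
dispersedFrom h       (U ∷ s)  = dispersedFrom (suc h) s
dispersedFrom zero    (D ∷ s)  = false
dispersedFrom (suc h) (D ∷ s)  = dispersedFrom h s
dispersedFrom zero    (H ∷ s)  = dispersedFrom zero s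
dispersedFrom (suc h) (H ∷ s)  = false

isDispersedDyck : List Step → Bool
isDispersedDyck = dispersedFrom zero

closeRun : ℕ → ℕ
closeRun (suc zero) = 1
closeRun _          = 0

oneAscentsFrom : ℕ → List Step → ℕ
oneAscentsFrom r []      = closeRun r
oneAscentsFrom r (U ∷ s) = oneAscentsFrom (suc r) s
oneAscentsFrom r (D ∷ s) = closeRun r Data.Nat.+ oneAscentsFrom zero s
oneAscentsFrom r (H ∷ s) = closeRun r Data.Nat.+ oneAscentsFrom zero s

-- number of 1-ascents (maximal U-runs of length exactly 1)
oneAscents : List Step → ℕ
oneAscents = oneAscentsFrom zero

A : ℕ → ℕ
A n = sum (map (λ p → if isDispersedDyck p then oneAscents p else 0) (allSeqs n))

Series : Set
Series = ℕ → ℤ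

ΣZ : ℕ → (ℕ → ℤ) → ℤ
ΣZ zero    f = + 0
ΣZ (suc k) f = ΣZ k f +ℤ f k

_⊛_ : Series → Series → Series
(f ⊛ g) n = ΣZ (suc n) (λ i → f i *ℤ g (n ∸ i))

infixl 7 _⊛_
infixl 6 _⊕_

_⊕_ : Series → Series → Series
(f ⊕ g) n = f n +ℤ g n

-- polynomial given by its coefficient list (constant term first)
poly : List ℤ → Series
poly []       n       = + 0
poly (c ∷ cs) zero    = c
poly (c ∷ cs) (suc n) = poly cs n

Aser : Series
Aser n = + (A n)

two oneMinus2z oneMinus4z² z² z³ one : Series
two         = poly (+ 2 ∷ [])
one         = poly (+ 1 ∷ [])
oneMinus2z  = poly (+ 1 ∷ - (+ 2) ∷ [])
oneMinus4z² = poly (+ 1 ∷ + 0 ∷ - (+ 4) ∷ [])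
z²          = poly (+ 0 ∷ + 0 ∷ + 1 ∷ [])
z³          = poly (+ 0 ∷ + 0 ∷ + 0 ∷ + 1 ∷ [])

-- Let paths h and ascents h r be the generating functions of the walks from height h back to
-- the axis (flat steps only on the axis) and of their 1-ascents, r being the length of the
-- current run of up steps.  Splitting off the first step gives a linear system which, since
-- every equation carries a factor z, determines paths (h + 1) and ascents (h + 1) r from
-- M = paths 0 and X0 = ascents 0 0.  A walk from height j + 1 is a first passage to height j
-- followed by a walk from height j; so if a = z (1 + a²) counts first passages and e counts
-- their 1-ascents, the solution is paths j = aʲ M, ascents (j + 1) 0 = a ascents j 0 + e paths j,
-- and ascents (j + 1) r differs from ascents (j + 1) 0 only through the next one or two steps.
-- The equations at height 0 then read M (1 - z - z a) = 1 and X0 (1 - z - z a) =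
-- z M (e + z - z² a), and √(1 - 4z²) = 1 - 2 z a turns them into the stated closed form.
module Submission where

open import Defs
open import Data.Nat using (ℕ)
open import Data.Integer using (+_)
open import Data.Product using (_×_)
open import Relation.Binary.PropositionalEquality using (_≡_)

open import Algebra.Bundles using (CommutativeRing)
import Algebra.Construct.Pointwise as Pointwise
import Algebra.Properties.CommutativeSemigroup as CommutativeSemigroupProperties
open import Algebra.Solver.Ring.AlmostCommutativeRing
  using (_-Raw-AlmostCommutative⟶_; fromCommutativeRing)
open import Data.Integer as ℤ using (ℤ)
  renaming (_+_ to _+ℤ_; _*_ to _*ℤ_; -_ to -ℤ_)
import Data.Integer.Properties as ℤ
open import Data.Maybe using (Maybe; just; nothing)
open import Data.Nat as ℕ using (zero; suc)
open import Data.Product using (_,_; uncurry)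
open import Relation.Nullary using (yes; no)

-- Identities in a commutative ring

-- ℤ⟶R lets the ring solver use integer coefficients.
module RingIdentities {c ℓ} (R : CommutativeRing c ℓ)
  (ℤ⟶R : ℤ.+-*-rawRing -Raw-AlmostCommutative⟶ fromCommutativeRing R)
  where

  open CommutativeRing R
  open _-Raw-AlmostCommutative⟶_ ℤ⟶R using () renaming (⟦_⟧ to ι)
  open import Algebra.Properties.Group +-group using (x≈y⇒x∙y⁻¹≈ε)
  import Relation.Binary.PropositionalEquality as ≡

  private
    coefficient≟ : ∀ m n → Maybe (ι m ≈ ι n)
    coefficient≟ m n with m ℤ.≟ n
    ... | yes m≡n = just (reflexive (≡.cong ι m≡n))
    ... | no _    = nothing

  open import Algebra.Solver.Ring ℤ.+-*-rawRing (fromCommutativeRing R) ℤ⟶R coefficient≟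
    using (solve; _:+_; _:*_; _:-_; :-_; con; _:=_)

  -- Every identity below that uses hypotheses is proved by a certificate: lhs − rhs is
  -- written as a combination of the hypotheses x − y, and the ring solver checks this.
  via-relation : ∀ {lhs rhs x y} q → x ≈ y → lhs ≈ rhs + q * (x - y) → lhs ≈ rhs
  via-relation {lhs} {rhs} {x} {y} q x≈y lhs≈ = begin
    lhs               ≈⟨ lhs≈ ⟩
    rhs + q * (x - y) ≈⟨ +-congˡ (*-congˡ (x≈y⇒x∙y⁻¹≈ε x≈y)) ⟩
    rhs + q * 0#      ≈⟨ +-congˡ (zeroʳ q) ⟩
    rhs + 0#          ≈⟨ +-identityʳ rhs ⟩
    rhs               ∎
    where open import Relation.Binary.Reasoning.Setoid setoid

  difference-of-squares : ∀ x y → (x - y) * (x + y) ≈ x * x - y * y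
  difference-of-squares = solve 2 (λ x y → (x :- y) :* (x :+ y) := x :* x :- y :* y) refl

  module ClosedForms (z a e M X0 : Carrier)
           (a-eq : a ≈ z * (ι (+ 1) + a * a))
           (e-eq : e ≈ z * (ι (+ 2) * a * e + z * a - z * z * a * a))
           where

    -- N j and X j stand for paths j and ascents j 0, and F j r for ascents (j + 1) r.
    N : ℕ → Carrier
    N zero    = M
    N (suc j) = a * N j

    X : ℕ → Carrier
    X zero    = X0
    X (suc j) = a * X j + e * N j

    F : ℕ → ℕ → Carrier
    F j zero          = X (suc j)
    F j (suc zero)    = X (suc j) + z * N j - z * z * N (suc j)
    F j (suc (suc _)) = X (suc j) - z * z * N (suc j)

    N-rec : ∀ j → N (suc j) ≈ z * (N (suc (suc j)) + N j)
    N-rec j = via-relation (N j) a-eq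
      (solve 3 (λ z a n → a :* n := z :* (a :* (a :* n) :+ n) :+ n :* (a :- z :* (con (+ 1) :+ a :* a)))
             refl z a (N j))

    F-rec : ∀ j r → F j r ≈ z * (F (suc j) (suc r) + ι (+ closeRun r) * N j + X j)
    F-rec j r = via-relation (X j) a-eq (via-relation (N j) e-eq (certificate r))
      where
      certificate : ∀ r →
        F j r ≈ z * (F (suc j) (suc r) + ι (+ closeRun r) * N j + X j)
                + X j * (a - z * (ι (+ 1) + a * a))
                + N j * (e - z * (ι (+ 2) * a * e + z * a - z * z * a * a))
      certificate zero = solve 5 (λ z a e x n →
        let x₁ = a :* x :+ e :* n
            x₂ = a :* x₁ :+ e :* (a :* n)
        in x₁ := z :* (x₂ :+ z :* (a :* n) :- z :* z :* (a :* (a :* n)) :+ con (+ 0) :* n :+ x)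
                 :+ x :* (a :- z :* (con (+ 1) :+ a :* a))
                 :+ n :* (e :- z :* (con (+ 2) :* a :* e :+ z :* a :- z :* z :* a :* a)))
        refl z a e (X j) (N j)
      certificate (suc zero) = solve 5 (λ z a e x n →
        let x₁ = a :* x :+ e :* n
            x₂ = a :* x₁ :+ e :* (a :* n)
        in x₁ :+ z :* n :- z :* z :* (a :* n)
             := z :* (x₂ :- z :* z :* (a :* (a :* n)) :+ con (+ 1) :* n :+ x)
                 :+ x :* (a :- z :* (con (+ 1) :+ a :* a))
                 :+ n :* (e :- z :* (con (+ 2) :* a :* e :+ z :* a :- z :* z :* a :* a)))
        refl z a e (X j) (N j)
      certificate (suc (suc r)) = solve 5 (λ z a e x n →
        let x₁ = a :* x :+ e :* n
            x₂ = a :* x₁ :+ e :* (a :* n)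
        in x₁ :- z :* z :* (a :* n)
             := z :* (x₂ :- z :* z :* (a :* (a :* n)) :+ con (+ 0) :* n :+ x)
                 :+ x :* (a :- z :* (con (+ 1) :+ a :* a))
                 :+ n :* (e :- z :* (con (+ 2) :* a :* e :+ z :* a :- z :* z :* a :* a)))
        refl z a e (X j) (N j)

    √[1-4z²] : Carrier
    √[1-4z²] = ι (+ 1) - ι (+ 2) * z * a

    √[1-4z²]-squared : √[1-4z²] * √[1-4z²] ≈ ι (+ 1) - ι (+ 4) * (z * z)
    √[1-4z²]-squared = via-relation (- (ι (+ 4) * z)) a-eq
      (solve 2 (λ z a →
        let t = con (+ 1) :- con (+ 2) :* z :* a
        in t :* t := con (+ 1) :- con (+ 4) :* (z :* z)
                     :+ :- (con (+ 4) :* z) :* (a :- z :* (con (+ 1) :+ a :* a)))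
        refl z a)

    e-√[1-4z²] : e * √[1-4z²] ≈ z * z * a * (ι (+ 1) - z * a)
    e-√[1-4z²] = via-relation (ι (+ 1)) e-eq
      (solve 3 (λ z a e →
        e :* (con (+ 1) :- con (+ 2) :* z :* a)
          := z :* z :* a :* (con (+ 1) :- z :* a)
             :+ con (+ 1) :* (e :- z :* (con (+ 2) :* a :* e :+ z :* a :- z :* z :* a :* a)))
        refl z a e)

    module _ (M-eq : M ≈ ι (+ 1) + z * (N 1 + N 0)) (X0-eq : X0 ≈ z * (F 0 1 + X0)) where

      M-inverse : M * (ι (+ 1) - z - z * a) ≈ ι (+ 1)
      M-inverse = via-relation (ι (+ 1)) M-eq
        (solve 3 (λ z a M →
          M :* (con (+ 1) :- z :- z :* a)
            := con (+ 1) :+ con (+ 1) :* (M :- (con (+ 1) :+ z :* (a :* M :+ M))))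
          refl z a M)

      X0-rearranged : X0 * (ι (+ 1) - z - z * a) ≈ z * M * (e + z - z * z * a)
      X0-rearranged = via-relation (ι (+ 1)) X0-eq
        (solve 5 (λ z a e M X0 →
          X0 :* (con (+ 1) :- z :- z :* a)
            := z :* M :* (e :+ z :- z :* z :* a)
               :+ con (+ 1) :* (X0 :- z :* ((a :* X0 :+ e :* M) :+ z :* M :- z :* z :* (a :* M) :+ X0)))
          refl z a e M X0)

      √[1-4z²]-X0 : √[1-4z²] * X0 ≈ z * z * (M * M) * ((ι (+ 1) - z * a) * (ι (+ 1) - z * a))
      √[1-4z²]-X0 =
        via-relation (- (√[1-4z²] * X0)) M-inverse
          (via-relation (√[1-4z²] * M) X0-rearranged
            (via-relation (z * M * M) e-√[1-4z²]
              (solve 5 (λ z a e M X0 →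
                let t = con (+ 1) :- con (+ 2) :* z :* a
                    u = con (+ 1) :- z :- z :* a
                    w = con (+ 1) :- z :* a
                in t :* X0 := z :* z :* (M :* M) :* (w :* w)
                              :+ :- (t :* X0) :* (M :* u :- con (+ 1))
                              :+ t :* M :* (X0 :* u :- z :* M :* (e :+ z :- z :* z :* a))
                              :+ z :* M :* M :* (e :* t :- z :* z :* a :* w))
                refl z a e M X0)))

      M²-inverse : (ι (+ 1) - ι (+ 2) * z) * (ι (+ 1) - z * a) * (M * M) ≈ ι (+ 1)
      M²-inverse =
        via-relation (M * (ι (+ 1) - z - z * a) + ι (+ 1)) M-inverse
          (via-relation (z * M * M) a-eq
            (solve 3 (λ z a M →
              let u = con (+ 1) :- z :- z :* a
              in (con (+ 1) :- con (+ 2) :* z) :* (con (+ 1) :- z :* a) :* (M :* M)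
                   := con (+ 1)
                      :+ (M :* u :+ con (+ 1)) :* (M :* u :- con (+ 1))
                      :+ z :* M :* M :* (a :- z :* (con (+ 1) :+ a :* a)))
              refl z a M))

      module _ (s : Carrier) (s≈√ : s ≈ √[1-4z²]) where

        X0-closed-form : ι (+ 2) * (ι (+ 1) - ι (+ 2) * z) * (ι (+ 1) - ι (+ 4) * (z * z)) * X0
                      ≈ z * z * ((ι (+ 1) - ι (+ 4) * (z * z)) + s)
        X0-closed-form =
          via-relation (z * z - ι (+ 2) * p * X0) √[1-4z²]-squared
            (via-relation (ι (+ 2) * p * √[1-4z²]) √[1-4z²]-X0
              (via-relation (ι (+ 2) * √[1-4z²] * z * z * (ι (+ 1) - z * a)) M²-inverse
                (via-relation (- (z * z)) s≈√
                  (solve 5 (λ z a M X0 s →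
                    let t = con (+ 1) :- con (+ 2) :* z :* a
                        w = con (+ 1) :- z :* a
                        p = con (+ 1) :- con (+ 2) :* z
                        q = con (+ 1) :- con (+ 4) :* (z :* z)
                    in con (+ 2) :* p :* q :* X0
                         := z :* z :* (q :+ s)
                            :+ (z :* z :- con (+ 2) :* p :* X0) :* (t :* t :- q)
                            :+ con (+ 2) :* p :* t :* (t :* X0 :- z :* z :* (M :* M) :* (w :* w))
                            :+ con (+ 2) :* t :* z :* z :* w :* (p :* w :* (M :* M) :- con (+ 1))
                            :+ :- (z :* z) :* (s :- t))
                    refl z a M X0 s))))
          where
          p = ι (+ 1) - ι (+ 2) * z

        X0-partial-fractions : ι (+ 2) * (ι (+ 1) - ι (+ 2) * z) * (ι (+ 1) - ι (+ 4) * (z * z)) * s * X0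
                       ≈ z * z * (ι (+ 1) - ι (+ 4) * (z * z)) * s + z * z * (ι (+ 1) - ι (+ 2) * z)
                         + ι (+ 2) * (z * (z * z)) * (ι (+ 1) - ι (+ 2) * z)
        X0-partial-fractions =
          via-relation s X0-closed-form
            (via-relation (z * z * (s + √[1-4z²])) s≈√
              (via-relation (z * z) √[1-4z²]-squared
                (solve 4 (λ z a X0 s →
                  let t = con (+ 1) :- con (+ 2) :* z :* a
                      p = con (+ 1) :- con (+ 2) :* z
                      q = con (+ 1) :- con (+ 4) :* (z :* z)
                  in con (+ 2) :* p :* q :* s :* X0
                       := z :* z :* q :* s :+ z :* z :* p :+ con (+ 2) :* (z :* (z :* z)) :* p
                          :+ s :* (con (+ 2) :* p :* q :* X0 :- z :* z :* (q :+ s))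
                          :+ z :* z :* (s :+ t) :* (s :- t)
                          :+ z :* z :* (t :* t :- q))
                  refl z a X0 s)))

-- Formal power series over ℤ

open import Data.Empty using (⊥-elim)
open import Data.List using (List; []; _∷_; map; concatMap; _++_)
open import Data.Nat using (_∸_; _<_; _≤_; z≤n; s≤s)
import Data.Nat.Properties as ℕ
open import Data.Sum using (inj₁; inj₂)
open import Level using (0ℓ)
open import Relation.Binary.PropositionalEquality
  using (refl; sym; trans; cong; cong₂; module ≡-Reasoning)
open import Relation.Nullary using (¬_)
open CommutativeSemigroupProperties ℤ.+-commutativeSemigroup
  using () renaming (interchange to +ℤ-interchange)

infix 4 _≈_ _≈[_]_

_≈_ : Series → Series → Set
f ≈ g = ∀ n → f n ≡ g n

_≈[_]_ : Series → ℕ → Series → Set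
f ≈[ n ] g = ∀ m → m < n → f m ≡ g m

≈[]-refl : ∀ {n} f → f ≈[ n ] f
≈[]-refl f m _ = refl

≈[]⇒≈ : ∀ {f g} → (∀ n → f ≈[ n ] g) → f ≈ g
≈[]⇒≈ agree n = agree (suc n) n ℕ.≤-refl

0ₛ : Series
0ₛ _ = + 0

-ₛ_ : Series → Series
(-ₛ f) n = -ℤ f n

fromℤ : ℤ → Series
fromℤ c = poly (c ∷ [])

z : Series
z = poly (+ 0 ∷ + 1 ∷ [])

tail : Series → Series
tail f n = f (suc n)

infixr 8 _·ₛ_
_·ₛ_ : ℤ → Series → Series
(c ·ₛ f) n = c *ℤ f n

ΣZ-cong< : ∀ k {f g : ℕ → ℤ} → (∀ i → i < k → f i ≡ g i) → ΣZ k f ≡ ΣZ k g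
ΣZ-cong< zero    eq = refl
ΣZ-cong< (suc k) eq =
  cong₂ _+ℤ_ (ΣZ-cong< k (λ i i<k → eq i (ℕ.m<n⇒m<1+n i<k))) (eq k ℕ.≤-refl)

ΣZ-zero : ∀ k → ΣZ k (λ _ → + 0) ≡ + 0
ΣZ-zero zero    = refl
ΣZ-zero (suc k) = trans (ℤ.+-identityʳ _) (ΣZ-zero k)

ΣZ-head : ∀ k (f : ℕ → ℤ) → ΣZ (suc k) f ≡ f 0 +ℤ ΣZ k (λ i → f (suc i))
ΣZ-head zero    f = trans (ℤ.+-identityˡ (f 0)) (sym (ℤ.+-identityʳ (f 0)))
ΣZ-head (suc k) f = trans (cong (_+ℤ f (suc k)) (ΣZ-head k f)) (ℤ.+-assoc (f 0) _ _)

⊛-cong[] : ∀ {n f f′ g g′} → f ≈[ n ] f′ → g ≈[ n ] g′ → f ⊛ g ≈[ n ] f′ ⊛ g′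
⊛-cong[] {f = f} {f′} {g} {g′} f≈f′ g≈g′ m m<n = ΣZ-cong< (suc m) λ i i≤m →
  cong₂ _*ℤ_ (f≈f′ i (ℕ.≤-<-trans (ℕ.≤-pred i≤m) m<n))
             (g≈g′ (m ∸ i) (ℕ.≤-<-trans (ℕ.m∸n≤m m i) m<n))

⊕-cong[] : ∀ {n f f′ g g′} → f ≈[ n ] f′ → g ≈[ n ] g′ → f ⊕ g ≈[ n ] f′ ⊕ g′
⊕-cong[] f≈f′ g≈g′ m m<n = cong₂ _+ℤ_ (f≈f′ m m<n) (g≈g′ m m<n)

⊛-cong : ∀ {f f′ g g′} → f ≈ f′ → g ≈ g′ → f ⊛ g ≈ f′ ⊛ g′
⊛-cong f≈f′ g≈g′ = ≈[]⇒≈ λ n → ⊛-cong[] (λ m _ → f≈f′ m) (λ m _ → g≈g′ m)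

-- The recursion (f g)ₙ₊₁ = f₀ gₙ₊₁ + (tail f · g)ₙ makes the ring laws provable by induction.
infixl 7 _⊙_
_⊙_ : Series → Series → Series
(f ⊙ g) zero    = f 0 *ℤ g 0
(f ⊙ g) (suc n) = f 0 *ℤ g (suc n) +ℤ (tail f ⊙ g) n

⊛≈⊙ : ∀ f g → f ⊛ g ≈ f ⊙ g
⊛≈⊙ f g zero    = ℤ.+-identityˡ _
⊛≈⊙ f g (suc n) =
  trans (ΣZ-head (suc n) _) (cong (f 0 *ℤ g (suc n) +ℤ_) (⊛≈⊙ (tail f) g n))

⊙-distribˡ : ∀ f g h n → (f ⊙ (g ⊕ h)) n ≡ (f ⊙ g) n +ℤ (f ⊙ h) n
⊙-distribˡ f g h zero    = ℤ.*-distribˡ-+ (f 0) (g 0) (h 0)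
⊙-distribˡ f g h (suc n) =
  trans (cong₂ _+ℤ_ (ℤ.*-distribˡ-+ (f 0) (g (suc n)) (h (suc n))) (⊙-distribˡ (tail f) g h n))
        (+ℤ-interchange (f 0 *ℤ g (suc n)) (f 0 *ℤ h (suc n)) ((tail f ⊙ g) n) ((tail f ⊙ h) n))

⊙-distribʳ : ∀ f g h n → ((g ⊕ h) ⊙ f) n ≡ (g ⊙ f) n +ℤ (h ⊙ f) n
⊙-distribʳ f g h zero    = ℤ.*-distribʳ-+ (f 0) (g 0) (h 0)
⊙-distribʳ f g h (suc n) =
  trans (cong₂ _+ℤ_ (ℤ.*-distribʳ-+ (f (suc n)) (g 0) (h 0)) (⊙-distribʳ f (tail g) (tail h) n))
        (+ℤ-interchange (g 0 *ℤ f (suc n)) (h 0 *ℤ f (suc n)) ((tail g ⊙ f) n) ((tail h ⊙ f) n))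

⊙-scaleˡ : ∀ c f g n → ((c ·ₛ f) ⊙ g) n ≡ c *ℤ (f ⊙ g) n
⊙-scaleˡ c f g zero    = ℤ.*-assoc c (f 0) (g 0)
⊙-scaleˡ c f g (suc n) =
  trans (cong₂ _+ℤ_ (ℤ.*-assoc c (f 0) (g (suc n))) (⊙-scaleˡ c (tail f) g n))
        (sym (ℤ.*-distribˡ-+ c (f 0 *ℤ g (suc n)) ((tail f ⊙ g) n)))

⊙-last : ∀ f g n → (f ⊙ g) (suc n) ≡ (f ⊙ tail g) n +ℤ f (suc n) *ℤ g 0
⊙-last f g zero    = refl
⊙-last f g (suc n) =
  trans (cong (f 0 *ℤ g (suc (suc n)) +ℤ_) (⊙-last (tail f) g n))
        (sym (ℤ.+-assoc (f 0 *ℤ g (suc (suc n))) ((tail f ⊙ tail g) n) (f (suc (suc n)) *ℤ g 0)))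

⊙-comm : ∀ f g n → (f ⊙ g) n ≡ (g ⊙ f) n
⊙-comm f g zero    = ℤ.*-comm (f 0) (g 0)
⊙-comm f g (suc n) =
  trans (cong₂ _+ℤ_ (ℤ.*-comm (f 0) (g (suc n))) (⊙-comm (tail f) g n))
        (trans (ℤ.+-comm (g (suc n) *ℤ f 0) ((g ⊙ tail f) n)) (sym (⊙-last g f n)))

⊙-assoc : ∀ f g h n → ((f ⊙ g) ⊙ h) n ≡ (f ⊙ (g ⊙ h)) n
⊙-assoc f g h zero    = ℤ.*-assoc (f 0) (g 0) (h 0)
⊙-assoc f g h (suc n) = begin
  f 0 *ℤ g 0 *ℤ h (suc n) +ℤ (((f 0 ·ₛ tail g) ⊕ tail f ⊙ g) ⊙ h) n
    ≡⟨ cong₂ _+ℤ_ (ℤ.*-assoc (f 0) (g 0) (h (suc n)))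
                   (trans (⊙-distribʳ h (f 0 ·ₛ tail g) (tail f ⊙ g) n)
                          (cong₂ _+ℤ_ (⊙-scaleˡ (f 0) (tail g) h n) (⊙-assoc (tail f) g h n))) ⟩
  f 0 *ℤ (g 0 *ℤ h (suc n)) +ℤ (f 0 *ℤ (tail g ⊙ h) n +ℤ (tail f ⊙ (g ⊙ h)) n)
    ≡⟨ sym (ℤ.+-assoc (f 0 *ℤ (g 0 *ℤ h (suc n))) _ _) ⟩
  f 0 *ℤ (g 0 *ℤ h (suc n)) +ℤ f 0 *ℤ (tail g ⊙ h) n +ℤ (tail f ⊙ (g ⊙ h)) n
    ≡⟨ cong (_+ℤ (tail f ⊙ (g ⊙ h)) n) (sym (ℤ.*-distribˡ-+ (f 0) _ _)) ⟩
  f 0 *ℤ (g ⊙ h) (suc n) +ℤ (tail f ⊙ (g ⊙ h)) n ∎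
  where open ≡-Reasoning

⊙-zeroˡ : ∀ f n → (0ₛ ⊙ f) n ≡ + 0
⊙-zeroˡ f zero    = refl
⊙-zeroˡ f (suc n) = trans (ℤ.+-identityˡ _) (⊙-zeroˡ f n)

fromℤ-⊙ : ∀ c f n → (fromℤ c ⊙ f) n ≡ c *ℤ f n
fromℤ-⊙ c f zero    = refl
fromℤ-⊙ c f (suc n) = trans (cong (c *ℤ f (suc n) +ℤ_) (⊙-zeroˡ f n)) (ℤ.+-identityʳ _)

fromℤ-⊛ : ∀ c f → fromℤ c ⊛ f ≈ c ·ₛ f
fromℤ-⊛ c f n = trans (⊛≈⊙ (fromℤ c) f n) (fromℤ-⊙ c f n)

⊛-identityˡ : ∀ f → one ⊛ f ≈ f
⊛-identityˡ f n = trans (fromℤ-⊛ (+ 1) f n) (ℤ.*-identityˡ (f n))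

⊛-comm : ∀ f g → f ⊛ g ≈ g ⊛ f
⊛-comm f g n = trans (⊛≈⊙ f g n) (trans (⊙-comm f g n) (sym (⊛≈⊙ g f n)))

⊛-identityʳ : ∀ f → f ⊛ one ≈ f
⊛-identityʳ f n = trans (⊛-comm f one n) (⊛-identityˡ f n)

⊛-assoc : ∀ f g h → (f ⊛ g) ⊛ h ≈ f ⊛ (g ⊛ h)
⊛-assoc f g h n = begin
  ((f ⊛ g) ⊛ h) n ≡⟨ ⊛-cong {g = h} (⊛≈⊙ f g) (λ _ → refl) n ⟩
  ((f ⊙ g) ⊛ h) n ≡⟨ ⊛≈⊙ (f ⊙ g) h n ⟩
  ((f ⊙ g) ⊙ h) n ≡⟨ ⊙-assoc f g h n ⟩
  (f ⊙ (g ⊙ h)) n ≡⟨ sym (⊛≈⊙ f (g ⊙ h) n) ⟩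
  (f ⊛ (g ⊙ h)) n ≡⟨ ⊛-cong {f = f} (λ _ → refl) (λ m → sym (⊛≈⊙ g h m)) n ⟩
  (f ⊛ (g ⊛ h)) n ∎
  where open ≡-Reasoning

⊛-distribˡ : ∀ f g h → f ⊛ (g ⊕ h) ≈ f ⊛ g ⊕ f ⊛ h
⊛-distribˡ f g h n =
  trans (⊛≈⊙ f (g ⊕ h) n)
        (trans (⊙-distribˡ f g h n) (sym (cong₂ _+ℤ_ (⊛≈⊙ f g n) (⊛≈⊙ f h n))))

⊛-distribʳ : ∀ f g h → (g ⊕ h) ⊛ f ≈ g ⊛ f ⊕ h ⊛ f
⊛-distribʳ f g h n =
  trans (⊛≈⊙ (g ⊕ h) f n)
        (trans (⊙-distribʳ f g h n) (sym (cong₂ _+ℤ_ (⊛≈⊙ g f n) (⊛≈⊙ h f n))))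

seriesRing : CommutativeRing 0ℓ 0ℓ
seriesRing = record
  { Carrier           = Series
  ; _≈_               = _≈_
  ; _+_               = _⊕_
  ; _*_               = _⊛_
  ; -_                = -ₛ_
  ; 0#                = 0ₛ
  ; 1#                = one
  ; isCommutativeRing = record
    { isRing = record
      { +-isAbelianGroup = Pointwise.isAbelianGroup ℕ ℤ.+-0-isAbelianGroup
      ; *-cong           = ⊛-cong
      ; *-assoc          = ⊛-assoc
      ; *-identity       = ⊛-identityˡ , ⊛-identityʳ
      ; distrib          = ⊛-distribˡ , ⊛-distribʳ
      }
    ; *-comm = ⊛-comm
    }
  }

z⊛-suc : ∀ f n → (z ⊛ f) (suc n) ≡ f n
z⊛-suc f n = begin
  (z ⊛ f) (suc n)          ≡⟨ ⊛≈⊙ z f (suc n) ⟩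
  + 0 +ℤ (one ⊙ f) n       ≡⟨ ℤ.+-identityˡ _ ⟩
  (one ⊙ f) n              ≡⟨ sym (⊛≈⊙ one f n) ⟩
  (one ⊛ f) n              ≡⟨ ⊛-identityˡ f n ⟩
  f n                      ∎
  where open ≡-Reasoning

z⊛-cong[] : ∀ {n f g} → f ≈[ n ] g → z ⊛ f ≈[ suc n ] z ⊛ g
z⊛-cong[] f≈g zero    _         = refl
z⊛-cong[] {f = f} {g} f≈g (suc m) (s≤s m<n) =
  trans (z⊛-suc f m) (trans (f≈g m m<n) (sym (z⊛-suc g m)))

fromℤ-homomorphism : ℤ.+-*-rawRing -Raw-AlmostCommutative⟶ fromCommutativeRing seriesRing
fromℤ-homomorphism = record
  { ⟦_⟧    = fromℤ
  ; +-homo = λ { c d zero → refl ; c d (suc n) → refl }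
  ; *-homo = λ { c d zero → sym (fromℤ-⊛ c (fromℤ d) 0)
               ; c d (suc n) → sym (trans (fromℤ-⊛ c (fromℤ d) (suc n)) (ℤ.*-zeroʳ c)) }
  ; -‿homo = λ { c zero → refl ; c (suc n) → refl }
  ; 0-homo = λ { zero → refl ; (suc n) → refl }
  ; 1-homo = λ _ → refl
  }

-- Once f vanishes below n, the coefficient of zⁿ in f u is fₙ u₀.
⊛-cancelʳ : ∀ {f u} → f ⊛ u ≈ 0ₛ → ¬ u 0 ≡ + 0 → f ≈ 0ₛ
⊛-cancelʳ {f} {u} fu≈0 u₀≢0 = ≈[]⇒≈ vanish
  where
  vanish : ∀ n → f ≈[ n ] 0ₛ
  vanish zero    m ()
  vanish (suc n) m (s≤s m≤n) with ℕ.m≤n⇒m<n∨m≡n m≤n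
  ... | inj₁ m<n  = vanish n m m<n
  ... | inj₂ refl with ℤ.i*j≡0⇒i≡0∨j≡0 (f m) leading
    where
    lower : ΣZ m (λ i → f i *ℤ u (m ∸ i)) ≡ + 0
    lower = trans (ΣZ-cong< m (λ i i<m → cong (_*ℤ u (m ∸ i)) (vanish m i i<m))) (ΣZ-zero m)
    leading : f m *ℤ u 0 ≡ + 0
    leading = begin
      f m *ℤ u 0               ≡⟨ cong (λ k → f m *ℤ u k) (sym (ℕ.n∸n≡0 m)) ⟩
      f m *ℤ u (m ∸ m)         ≡⟨ sym (ℤ.+-identityˡ _) ⟩
      + 0 +ℤ f m *ℤ u (m ∸ m)  ≡⟨ cong (_+ℤ f m *ℤ u (m ∸ m)) (sym lower) ⟩
      (f ⊛ u) m                ≡⟨ fu≈0 m ⟩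
      + 0                      ∎
      where open ≡-Reasoning
  ... | inj₁ fₘ≡0 = fₘ≡0
  ... | inj₂ u₀≡0 = ⊥-elim (u₀≢0 u₀≡0)

private
  module S = CommutativeRing seriesRing

open RingIdentities seriesRing fromℤ-homomorphism

square-root-unique : ∀ {s t} → s ⊛ s ≈ t ⊛ t → s 0 ≡ + 1 → t 0 ≡ + 1 → s ≈ t
square-root-unique {s} {t} s²≈t² s₀≡1 t₀≡1 =
  x∙y⁻¹≈ε⇒x≈y s t (⊛-cancelʳ {u = s ⊕ t} s²-t²≈0 s+t₀≢0)
  where
  open import Algebra.Properties.Group S.+-group using (x∙y⁻¹≈ε⇒x≈y; x≈y⇒x∙y⁻¹≈ε)
  s²-t²≈0 : (s S.- t) ⊛ (s ⊕ t) ≈ 0ₛ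
  s²-t²≈0 = S.trans (difference-of-squares s t) (x≈y⇒x∙y⁻¹≈ε s²≈t²)
  s+t₀≢0 : ¬ (s ⊕ t) 0 ≡ + 0
  s+t₀≢0 s+t₀≡0 with trans (sym (cong₂ _+ℤ_ s₀≡1 t₀≡1)) s+t₀≡0
  ... | ()

-- Contractive systems of equations

-- Φ is a contraction for the z-adic distance.
Contractive : {I : Set} → ((I → Series) → I → Series) → Set
Contractive {I} Φ =
  ∀ n {F G : I → Series} → (∀ i → F i ≈[ n ] G i) → ∀ i → Φ F i ≈[ suc n ] Φ G i

module FixedPoint {I : Set} {Φ : (I → Series) → I → Series} (contractive : Contractive Φ) where

  approx : ℕ → I → Series
  approx zero    _ = 0ₛ
  approx (suc k) = Φ (approx k)

  approx-agree : ∀ {j k} → j ≤ k → ∀ i → approx j i ≈[ j ] approx k i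
  approx-agree z≤n       i m ()
  approx-agree (s≤s j≤k) = contractive _ (approx-agree j≤k)

  fix : I → Series
  fix i n = approx (suc n) i n

  fix-isFixed : ∀ i → fix i ≈ Φ fix i
  fix-isFixed i n = contractive n approx≈fix i n ℕ.≤-refl
    where
    approx≈fix : ∀ i → approx n i ≈[ n ] fix i
    approx≈fix i m m<n = sym (approx-agree m<n i m ℕ.≤-refl)

  unique : ∀ {F G} → (∀ i → F i ≈ Φ F i) → (∀ i → G i ≈ Φ G i) → ∀ i → F i ≈ G i
  unique {F} {G} F-fixed G-fixed i = ≈[]⇒≈ (λ n → agree n i)
    where
    agree : ∀ n i → F i ≈[ n ] G i
    agree zero    i m ()
    agree (suc n) i m m<n =
      trans (F-fixed i m) (trans (contractive n (agree n) i m m<n) (sym (G-fixed i m)))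

-- Counting walks by their first step

open import Data.Bool using (true; false; if_then_else_)
open import Data.List.Properties using (map-++; map-cong)
open import Data.Nat using (_+_; _*_)
open import Data.Nat.ListAction using (sum)
open import Data.Nat.ListAction.Properties using (sum-++)
open CommutativeSemigroupProperties ℕ.+-commutativeSemigroup
  using () renaming (interchange to +-interchange)

module _ {A : Set} where

  sum-map-+ : ∀ (f g : A → ℕ) xs →
              sum (map (λ x → f x + g x) xs) ≡ sum (map f xs) + sum (map g xs)
  sum-map-+ f g []       = refl
  sum-map-+ f g (x ∷ xs) =
    trans (cong (λ k → f x + g x + k) (sum-map-+ f g xs)) (+-interchange (f x) (g x) _ _)

  sum-map-* : ∀ c (f : A → ℕ) xs → sum (map (λ x → c * f x) xs) ≡ c * sum (map f xs)
  sum-map-* c f []       = sym (ℕ.*-zeroʳ c)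
  sum-map-* c f (x ∷ xs) =
    trans (cong (λ k → c * f x + k) (sum-map-* c f xs)) (sym (ℕ.*-distribˡ-+ c (f x) _))

total : (List Step → ℕ) → Series
total w n = + sum (map w (allSeqs n))

total-cong : ∀ {v w} → (∀ p → v p ≡ w p) → total v ≈ total w
total-cong v≗w n = cong (λ xs → + sum xs) (map-cong v≗w (allSeqs n))

total-+ : ∀ v w → total (λ p → v p + w p) ≈ total v ⊕ total w
total-+ v w n =
  trans (cong +_ (sum-map-+ v w (allSeqs n)))
        (ℤ.pos-+ (sum (map v (allSeqs n))) (sum (map w (allSeqs n))))

total-* : ∀ c w → total (λ p → c * w p) ≈ fromℤ (+ c) ⊛ total w
total-* c w n =
  trans (cong +_ (sum-map-* c w (allSeqs n)))
        (trans (ℤ.pos-* c _) (sym (fromℤ-⊛ (+ c) (total w) n)))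

first-step : ∀ w →
  total w ≈ fromℤ (+ w []) ⊕ z ⊛ total (λ p → w (U ∷ p) + w (D ∷ p) + w (H ∷ p))
first-step w zero    = refl
first-step w (suc n) = begin
  + sum (map w (concatMap extend (allSeqs n)))  ≡⟨ cong +_ (sum-extend (allSeqs n)) ⟩
  total w′ n                                    ≡⟨ sym (z⊛-suc (total w′) n) ⟩
  (z ⊛ total w′) (suc n)                        ≡⟨ sym (ℤ.+-identityˡ _) ⟩
  + 0 +ℤ (z ⊛ total w′) (suc n)                 ∎
  where
  open ≡-Reasoning
  extend : List Step → List (List Step)
  extend p = (U ∷ p) ∷ (D ∷ p) ∷ (H ∷ p) ∷ []
  w′ : List Step → ℕ
  w′ p = w (U ∷ p) + w (D ∷ p) + w (H ∷ p)
  sum-extend : ∀ ps → sum (map w (concatMap extend ps)) ≡ sum (map w′ ps)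
  sum-extend []       = refl
  sum-extend (p ∷ ps) = begin
    sum (map w (extend p ++ concatMap extend ps))
      ≡⟨ cong sum (map-++ w (extend p) (concatMap extend ps)) ⟩
    sum (map w (extend p) ++ map w (concatMap extend ps))
      ≡⟨ sum-++ (map w (extend p)) (map w (concatMap extend ps)) ⟩
    w (U ∷ p) + (w (D ∷ p) + (w (H ∷ p) + 0)) + sum (map w (concatMap extend ps))
      ≡⟨ cong₂ _+_ (trans (cong (λ k → w (U ∷ p) + (w (D ∷ p) + k)) (ℕ.+-identityʳ _))
                          (sym (ℕ.+-assoc (w (U ∷ p)) _ _)))
                   (sum-extend ps) ⟩
    w′ p + sum (map w′ ps) ∎

isPath : ℕ → List Step → ℕ
isPath h p = if dispersedFrom h p then 1 else 0

ascentWeight : ℕ → ℕ → List Step → ℕ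
ascentWeight h r p = if dispersedFrom h p then oneAscentsFrom r p else 0

paths : ℕ → Series
paths h = total (isPath h)

ascents : ℕ → ℕ → Series
ascents h r = total (ascentWeight h r)

private
  fromℤ0-⊕ : ∀ f → fromℤ (+ 0) ⊕ f ≈ f
  fromℤ0-⊕ f zero    = ℤ.+-identityˡ (f 0)
  fromℤ0-⊕ f (suc n) = ℤ.+-identityˡ (f (suc n))

open import Relation.Binary.Reasoning.Setoid S.setoid

paths-rec₀ : paths 0 ≈ one ⊕ z ⊛ (paths 1 ⊕ paths 0)
paths-rec₀ = begin
  paths 0
    ≈⟨ first-step (isPath 0) ⟩
  one ⊕ z ⊛ total (λ p → isPath 1 p + 0 + isPath 0 p)
    ≈⟨ S.+-congˡ {one} (S.*-congˡ {z} (total-cong weights)) ⟩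
  one ⊕ z ⊛ total (λ p → isPath 1 p + isPath 0 p)
    ≈⟨ S.+-congˡ {one} (S.*-congˡ {z} (total-+ (isPath 1) (isPath 0))) ⟩
  one ⊕ z ⊛ (paths 1 ⊕ paths 0) ∎
  where
  weights : ∀ p → isPath 1 p + 0 + isPath 0 p ≡ isPath 1 p + isPath 0 p
  weights p = cong (_+ isPath 0 p) (ℕ.+-identityʳ (isPath 1 p))

paths-rec : ∀ h → paths (suc h) ≈ z ⊛ (paths (suc (suc h)) ⊕ paths h)
paths-rec h = begin
  paths (suc h)
    ≈⟨ first-step (isPath (suc h)) ⟩
  fromℤ (+ 0) ⊕ z ⊛ total (λ p → isPath h₂ p + isPath h p + 0)
    ≈⟨ fromℤ0-⊕ _ ⟩
  z ⊛ total (λ p → isPath h₂ p + isPath h p + 0)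
    ≈⟨ S.*-congˡ {z} (total-cong (λ p → ℕ.+-identityʳ (isPath h₂ p + isPath h p))) ⟩
  z ⊛ total (λ p → isPath h₂ p + isPath h p)
    ≈⟨ S.*-congˡ {z} (total-+ (isPath h₂) (isPath h)) ⟩
  z ⊛ (paths h₂ ⊕ paths h) ∎
  where
  h₂ = suc (suc h)

ascents-rec₀ : ascents 0 0 ≈ z ⊛ (ascents 1 1 ⊕ ascents 0 0)
ascents-rec₀ = begin
  ascents 0 0
    ≈⟨ first-step (ascentWeight 0 0) ⟩
  fromℤ (+ 0) ⊕ z ⊛ total (λ p → up p + 0 + ascentWeight 0 0 p)
    ≈⟨ fromℤ0-⊕ _ ⟩
  z ⊛ total (λ p → up p + 0 + ascentWeight 0 0 p)
    ≈⟨ S.*-congˡ {z} (total-cong weights) ⟩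
  z ⊛ total (λ p → up p + ascentWeight 0 0 p)
    ≈⟨ S.*-congˡ {z} (total-+ up (ascentWeight 0 0)) ⟩
  z ⊛ (ascents 1 1 ⊕ ascents 0 0) ∎
  where
  up = ascentWeight 1 1
  weights : ∀ p → up p + 0 + ascentWeight 0 0 p ≡ up p + ascentWeight 0 0 p
  weights p = cong (_+ ascentWeight 0 0 p) (ℕ.+-identityʳ (up p))

down-weight : ∀ h r p →
  ascentWeight (suc h) r (D ∷ p) ≡ closeRun r * isPath h p + ascentWeight h 0 p
down-weight h r p with dispersedFrom h p
... | true  = cong (_+ oneAscentsFrom 0 p) (sym (ℕ.*-identityʳ (closeRun r)))
... | false = sym (trans (ℕ.+-identityʳ (closeRun r * 0)) (ℕ.*-zeroʳ (closeRun r)))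

ascents-rec : ∀ h r → ascents (suc h) r
  ≈ z ⊛ (ascents (suc (suc h)) (suc r) ⊕ fromℤ (+ closeRun r) ⊛ paths h ⊕ ascents h 0)
ascents-rec h r = begin
  ascents (suc h) r
    ≈⟨ first-step (ascentWeight (suc h) r) ⟩
  fromℤ (+ 0) ⊕ z ⊛ total (λ p → up p + ascentWeight (suc h) r (D ∷ p) + 0)
    ≈⟨ fromℤ0-⊕ _ ⟩
  z ⊛ total (λ p → up p + ascentWeight (suc h) r (D ∷ p) + 0)
    ≈⟨ S.*-congˡ {z} (total-cong weights) ⟩
  z ⊛ total (λ p → up p + c * isPath h p + ascentWeight h 0 p)
    ≈⟨ S.*-congˡ {z} (total-+ (λ p → up p + c * isPath h p) (ascentWeight h 0)) ⟩
  z ⊛ (total (λ p → up p + c * isPath h p) ⊕ ascents h 0)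
    ≈⟨ S.*-congˡ {z} (S.+-congʳ {ascents h 0} (total-+ up (λ p → c * isPath h p))) ⟩
  z ⊛ (total up ⊕ total (λ p → c * isPath h p) ⊕ ascents h 0)
    ≈⟨ S.*-congˡ {z} (S.+-congʳ {ascents h 0} (S.+-congˡ {total up} (total-* c (isPath h)))) ⟩
  z ⊛ (ascents (suc (suc h)) (suc r) ⊕ fromℤ (+ c) ⊛ paths h ⊕ ascents h 0) ∎
  where
  c = closeRun r
  up = ascentWeight (suc (suc h)) (suc r)
  weights : ∀ p → up p + ascentWeight (suc h) r (D ∷ p) + 0
                ≡ up p + c * isPath h p + ascentWeight h 0 p
  weights p = trans (ℕ.+-identityʳ _)
    (trans (cong (λ k → up p + k) (down-weight h r p)) (sym (ℕ.+-assoc (up p) _ _)))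

-- Solving the system

open import Data.Unit using (⊤; tt)

-- A first passage from height h + 1 to h is either D or U P P′, with first passages P from
-- h + 2 and P′ from h + 1.  The new U is a 1-ascent exactly when P = D, and it destroys the
-- leading 1-ascent of P when P starts with U D.
Φa : (⊤ → Series) → ⊤ → Series
Φa F _ = z ⊛ (one ⊕ F tt ⊛ F tt)

Φa-contractive : Contractive Φa
Φa-contractive n F≈G _ = z⊛-cong[] (⊕-cong[] (≈[]-refl one) (⊛-cong[] (F≈G tt) (F≈G tt)))

a : Series
a = FixedPoint.fix Φa-contractive tt

Φe : (⊤ → Series) → ⊤ → Series
Φe F _ = z ⊛ (fromℤ (+ 2) ⊛ a ⊛ F tt ⊕ z ⊛ a ⊕ -ₛ (z ⊛ z ⊛ a ⊛ a))

Φe-contractive : Contractive Φe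
Φe-contractive n F≈G _ =
  z⊛-cong[] (⊕-cong[] (⊕-cong[] (⊛-cong[] (≈[]-refl (fromℤ (+ 2) ⊛ a)) (F≈G tt))
                                (≈[]-refl (z ⊛ a)))
                      (≈[]-refl (-ₛ (z ⊛ z ⊛ a ⊛ a))))

e : Series
e = FixedPoint.fix Φe-contractive tt

open ClosedForms z a e (paths 0) (ascents 0 0)
  (FixedPoint.fix-isFixed Φa-contractive tt) (FixedPoint.fix-isFixed Φe-contractive tt)

Φpaths : (ℕ → Series) → ℕ → Series
Φpaths Y zero    = paths 0
Φpaths Y (suc j) = z ⊛ (Y (suc (suc j)) ⊕ Y j)

Φpaths-contractive : Contractive Φpaths
Φpaths-contractive n F≈G zero    = ≈[]-refl (paths 0)
Φpaths-contractive n F≈G (suc j) = z⊛-cong[] (⊕-cong[] (F≈G (suc (suc j))) (F≈G j))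

paths≈N : ∀ j → paths j ≈ N j
paths≈N = FixedPoint.unique Φpaths-contractive paths-isFixed N-isFixed
  where
  paths-isFixed : ∀ j → paths j ≈ Φpaths paths j
  paths-isFixed zero    = S.refl
  paths-isFixed (suc j) = paths-rec j
  N-isFixed : ∀ j → N j ≈ Φpaths N j
  N-isFixed zero    = S.refl
  N-isFixed (suc j) = N-rec j

Φascents : (ℕ × ℕ → Series) → ℕ × ℕ → Series
Φascents Y (zero , r)  = z ⊛ (Y (1 , suc r) ⊕ fromℤ (+ closeRun r) ⊛ N 0 ⊕ ascents 0 0)
Φascents Y (suc j , r) =
  z ⊛ (Y (suc (suc j) , suc r) ⊕ fromℤ (+ closeRun r) ⊛ N (suc j) ⊕ Y (j , 0))

Φascents-contractive : Contractive Φascents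
Φascents-contractive n F≈G (zero , r) =
  z⊛-cong[] (⊕-cong[] (⊕-cong[] (F≈G (1 , suc r)) (≈[]-refl (fromℤ (+ closeRun r) ⊛ N 0)))
                      (≈[]-refl (ascents 0 0)))
Φascents-contractive n F≈G (suc j , r) =
  z⊛-cong[] (⊕-cong[] (⊕-cong[] (F≈G (suc (suc j) , suc r))
                                (≈[]-refl (fromℤ (+ closeRun r) ⊛ N (suc j))))
                      (F≈G (j , 0)))

ascents≈F : ∀ j r → ascents (suc j) r ≈ F j r
ascents≈F j r = FixedPoint.unique Φascents-contractive ascents-isFixed F-isFixed (j , r)
  where
  ascents⁺ : ℕ × ℕ → Series
  ascents⁺ (j , r) = ascents (suc j) r
  ascents-isFixed : ∀ i → ascents⁺ i ≈ Φascents ascents⁺ i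
  ascents-isFixed (zero , r)  = ascents-rec 0 r
  ascents-isFixed (suc j , r) = S.trans (ascents-rec (suc j) r)
    (S.*-congˡ {z} (S.+-congʳ {ascents (suc j) 0} (S.+-congˡ {ascents (suc (suc (suc j))) (suc r)}
      (S.*-congˡ {fromℤ (+ closeRun r)} (paths≈N (suc j))))))
  F-isFixed : ∀ i → uncurry F i ≈ Φascents (uncurry F) i
  F-isFixed (zero , r)  = F-rec 0 r
  F-isFixed (suc j , r) = F-rec (suc j) r

paths-equation : paths 0 ≈ one ⊕ z ⊛ (N 1 ⊕ N 0)
paths-equation = S.trans paths-rec₀ (S.+-congˡ {one} (S.*-congˡ {z} (S.+-congʳ {paths 0} (paths≈N 1))))

ascents-equation : ascents 0 0 ≈ z ⊛ (F 0 1 ⊕ ascents 0 0)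
ascents-equation = S.trans ascents-rec₀ (S.*-congˡ {z} (S.+-congʳ {ascents 0 0} (ascents≈F 0 1)))

z²-≈ : z² ≈ z ⊛ z
z²-≈ zero    = refl
z²-≈ (suc n) = sym (z⊛-suc z n)

z³-≈ : z³ ≈ z ⊛ (z ⊛ z)
z³-≈ zero    = refl
z³-≈ (suc n) = trans (z²-≈ n) (sym (z⊛-suc (z ⊛ z) n))

oneMinus2z-≈ : oneMinus2z ≈ one S.- fromℤ (+ 2) ⊛ z
oneMinus2z-≈ n = sym (trans (cong (λ c → one n +ℤ -ℤ c) (fromℤ-⊛ (+ 2) z n)) (coefficient n))
  where
  coefficient : ∀ n → one n +ℤ -ℤ (+ 2 *ℤ z n) ≡ oneMinus2z n
  coefficient zero          = refl
  coefficient (suc zero)    = refl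
  coefficient (suc (suc n)) = refl

oneMinus4z²-≈ : oneMinus4z² ≈ one S.- fromℤ (+ 4) ⊛ (z ⊛ z)
oneMinus4z²-≈ n =
  sym (trans (cong (λ c → one n +ℤ -ℤ c)
                   (trans (fromℤ-⊛ (+ 4) (z ⊛ z) n) (cong (+ 4 *ℤ_) (sym (z²-≈ n)))))
             (coefficient n))
  where
  coefficient : ∀ n → one n +ℤ -ℤ (+ 4 *ℤ z² n) ≡ oneMinus4z² n
  coefficient zero                = refl
  coefficient (suc zero)          = refl
  coefficient (suc (suc zero))    = refl
  coefficient (suc (suc (suc n))) = refl

denominator-≈ : two ⊛ oneMinus2z ⊛ oneMinus4z²
                ≈ fromℤ (+ 2) ⊛ (one S.- fromℤ (+ 2) ⊛ z) ⊛ (one S.- fromℤ (+ 4) ⊛ (z ⊛ z))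
denominator-≈ = S.*-cong {x = two ⊛ oneMinus2z} (S.*-congˡ {two} oneMinus2z-≈) oneMinus4z²-≈

√[1-4z²]-unique : ∀ {s} → s 0 ≡ + 1 → s ⊛ s ≈ oneMinus4z² → s ≈ √[1-4z²]
√[1-4z²]-unique s₀≡1 s²≈ =
  square-root-unique (S.trans s²≈ (S.trans oneMinus4z²-≈ (S.sym √[1-4z²]-squared))) s₀≡1 refl

partial-fractions-≈ : ∀ s →
  z² ⊛ oneMinus4z² ⊛ s ⊕ z² ⊛ oneMinus2z ⊕ two ⊛ z³ ⊛ oneMinus2z
  ≈ z ⊛ z ⊛ (one S.- fromℤ (+ 4) ⊛ (z ⊛ z)) ⊛ s ⊕ z ⊛ z ⊛ (one S.- fromℤ (+ 2) ⊛ z)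
    ⊕ fromℤ (+ 2) ⊛ (z ⊛ (z ⊛ z)) ⊛ (one S.- fromℤ (+ 2) ⊛ z)
partial-fractions-≈ s =
  S.+-cong {x = z² ⊛ oneMinus4z² ⊛ s ⊕ z² ⊛ oneMinus2z}
    (S.+-cong {x = z² ⊛ oneMinus4z² ⊛ s}
      (S.*-congʳ {s} (S.*-cong {x = z²} z²-≈ oneMinus4z²-≈))
      (S.*-cong {x = z²} z²-≈ oneMinus2z-≈))
    (S.*-cong {x = two ⊛ z³} (S.*-congˡ {two} z³-≈) oneMinus2z-≈)

mainTheorem2 : (s : Series) → s 0 ≡ + 1 → (∀ n → (s ⊛ s) n ≡ oneMinus4z² n) →
    (∀ n → (two ⊛ oneMinus2z ⊛ oneMinus4z² ⊛ Aser) n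
             ≡ (z² ⊛ (oneMinus4z² ⊕ s)) n)
    × (∀ n → (two ⊛ oneMinus2z ⊛ oneMinus4z² ⊛ s ⊛ Aser) n
             ≡ (z² ⊛ oneMinus4z² ⊛ s ⊕ z² ⊛ oneMinus2z ⊕ two ⊛ z³ ⊛ oneMinus2z) n)
mainTheorem2 s s₀≡1 s²≈ = first , second
  where
  s≈√ : s ≈ √[1-4z²]
  s≈√ = √[1-4z²]-unique s₀≡1 s²≈
  first : two ⊛ oneMinus2z ⊛ oneMinus4z² ⊛ Aser ≈ z² ⊛ (oneMinus4z² ⊕ s)
  first = begin
    two ⊛ oneMinus2z ⊛ oneMinus4z² ⊛ Aser
      ≈⟨ S.*-congʳ {Aser} denominator-≈ ⟩
    fromℤ (+ 2) ⊛ (one S.- fromℤ (+ 2) ⊛ z) ⊛ (one S.- fromℤ (+ 4) ⊛ (z ⊛ z)) ⊛ ascents 0 0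
      ≈⟨ X0-closed-form paths-equation ascents-equation s s≈√ ⟩
    z ⊛ z ⊛ ((one S.- fromℤ (+ 4) ⊛ (z ⊛ z)) ⊕ s)
      ≈⟨ S.sym (S.*-cong {x = z²} z²-≈ (S.+-congʳ {s} oneMinus4z²-≈)) ⟩
    z² ⊛ (oneMinus4z² ⊕ s) ∎
  second : two ⊛ oneMinus2z ⊛ oneMinus4z² ⊛ s ⊛ Aser
           ≈ z² ⊛ oneMinus4z² ⊛ s ⊕ z² ⊛ oneMinus2z ⊕ two ⊛ z³ ⊛ oneMinus2z
  second = begin
    two ⊛ oneMinus2z ⊛ oneMinus4z² ⊛ s ⊛ Aser
      ≈⟨ S.*-congʳ {Aser} (S.*-congʳ {s} denominator-≈) ⟩
    fromℤ (+ 2) ⊛ (one S.- fromℤ (+ 2) ⊛ z) ⊛ (one S.- fromℤ (+ 4) ⊛ (z ⊛ z)) ⊛ s ⊛ ascents 0 0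
      ≈⟨ X0-partial-fractions paths-equation ascents-equation s s≈√ ⟩
    z ⊛ z ⊛ (one S.- fromℤ (+ 4) ⊛ (z ⊛ z)) ⊛ s ⊕ z ⊛ z ⊛ (one S.- fromℤ (+ 2) ⊛ z)
      ⊕ fromℤ (+ 2) ⊛ (z ⊛ (z ⊛ z)) ⊛ (one S.- fromℤ (+ 2) ⊛ z)
      ≈⟨ S.sym (partial-fractions-≈ s) ⟩
    z² ⊛ oneMinus4z² ⊛ s ⊕ z² ⊛ oneMinus2z ⊕ two ⊛ z³ ⊛ oneMinus2z ∎
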